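{- Let $G$ be an oriented two-colored graph on $X$. If $G$ is not connected, or if its underlying undirected multigraph contains a cycle (including a pair of parallel edges), then the class of $G$ in $\mathscr{Eil}_2(n)$ is $0$.
   Context: Let $R$ be a commutative ring with unit, $X=\{x_1<\dots<x_n\}$. An oriented two-colored graph on $X$ is a directed multigraph on vertex set $X$ (not necessarily connected) whose edges are colored red or blue; $\Gamma_n$ is the free $R$-module on these. For such a graph $H$ and a colored directed edge $e$ write $H+e$ for the graph with $e$ added. $I_n\subseteq\Gamma_n$ is the submodule generated by: (a) $(H+(i\to j))+(H+(j\to i))$, both added edges of the same color; (b) $\sum_{(a,b,c)}(H+(a\to b)+(b\to c))$, sum over cyclic rotations $(a,b,c)\in\{(i,j,k),(j,k,i),(k,i,j)\}$ of distinct vertices $i,j,k$, all added edges of one common color; (c) $\sum_{(a,b,c)}\big[(H+(a\to b)_{\mathrm{blue}}+(b\to c)_{\mathrm{red}})+(H+(a\to b)_{\mathrm{red}}+(b\to c)_{\mathrm{blue}})\big]$ over the same rotations; (d) graphs with more than one edge between some pair of vertices; (e) disconnected graphs. $\mathscr{Eil}_2(n)=\Gamma_n/I_n$. -}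

module Defs where

open import Level using (Level; _⊔_)
open import Data.Nat as ℕ using (ℕ; zero; suc; _≥_)
open import Data.Fin as Fin using (Fin; inject₁; fromℕ)
open import Data.Fin.Properties as FinP using (all?)
open import Data.List using (List; []; _∷_; map; foldr)
open import Data.Product using (Σ; _×_; _,_; ∃; proj₁; proj₂)
open import Data.Sum using (_⊎_)
open import Data.Empty using (⊥-elim)
open import Function.Definitions using (Injective)
open import Relation.Nullary using (¬_; Dec; yes; no)
open import Relation.Nullary.Decidable using (map′)
open import Relation.Binary.PropositionalEquality using (_≡_; _≢_; refl; sym; trans; cong)
open import Relation.Binary.Construct.Closure.ReflexiveTransitive using (Star)
open import Algebra.Bundles using (CommutativeRing)

data Color : Set where
  red blue : Color

_≟c_ : (c d : Color) → Dec (c ≡ d)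
red  ≟c red  = yes refl
red  ≟c blue = no λ ()
blue ≟c red  = no λ ()
blue ≟c blue = yes refl

record Graph (n : ℕ) : Set where
  field
    mult   : Fin n → Fin n → Color → ℕ
    noLoop : ∀ i c → mult i i c ≡ 0
open Graph public

_≈G_ : ∀ {n} → Graph n → Graph n → Set
G ≈G H = ∀ i j c → mult G i j c ≡ mult H i j c

_≟Col-all_ : ∀ {m m' : Color → ℕ} → Dec (∀ c → m c ≡ m' c)
_≟Col-all_ {m} {m'} with m red ℕ.≟ m' red | m blue ℕ.≟ m' blue
... | yes p | yes q = yes λ { red → p ; blue → q }
... | no ¬p | _     = no λ f → ¬p (f red)
... | yes _ | no ¬q = no λ f → ¬q (f blue)

_≟G_ : ∀ {n} (G H : Graph n) → Dec (G ≈G H)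
G ≟G H = all? λ i → all? λ j → _≟Col-all_ {mult G i j} {mult H i j}

addEdge : ∀ {n} (H : Graph n) (i j : Fin n) → i ≢ j → Color → Graph n
addEdge {n} H i j i≢j c = record { mult = m ; noLoop = nl }
  where
  m : Fin n → Fin n → Color → ℕ
  m x y d with x Fin.≟ i | y Fin.≟ j | d ≟c c
  ... | yes _ | yes _ | yes _ = suc (mult H x y d)
  ... | _     | _     | _     = mult H x y d
  nl : ∀ x d → m x x d ≡ 0
  nl x d with x Fin.≟ i | x Fin.≟ j | d ≟c c
  ... | yes p | yes q | yes _ = ⊥-elim (i≢j (trans (sym p) q))
  ... | yes _ | yes _ | no _  = noLoop H x d
  ... | yes _ | no _  | _     = noLoop H x d
  ... | no _  | _     | _     = noLoop H x d

between : ∀ {n} → Graph n → Fin n → Fin n → ℕ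
between G i j = mult G i j red ℕ.+ mult G i j blue ℕ.+ mult G j i red ℕ.+ mult G j i blue

Adj : ∀ {n} → Graph n → Fin n → Fin n → Set
Adj G i j = between G i j ≥ 1

Connected : ∀ {n} → Graph n → Set
Connected {n} G = ∀ (i j : Fin n) → Star (Adj G) i j

HasCycle : ∀ {n} → Graph n → Set
HasCycle {n} G =
    (Σ (Fin n) λ i → Σ (Fin n) λ j → i ≢ j × between G i j ≥ 2)
  ⊎ (Σ ℕ λ m → Σ (Fin (3 ℕ.+ m) → Fin n) λ v →
       Injective _≡_ _≡_ v
     × (∀ (t : Fin (2 ℕ.+ m)) → Adj G (v (inject₁ t)) (v (Fin.suc t)))
     × Adj G (v (fromℕ (2 ℕ.+ m))) (v Fin.zero))

module Eil {c ℓ : Level} (R : CommutativeRing c ℓ) (n : ℕ) where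
  open CommutativeRing R

  -- an element of Γ_n as a formal R-linear combination of graphs
  Comb : Set c
  Comb = List (Carrier × Graph n)

  coeff : Comb → Graph n → Carrier
  coeff [] H = 0#
  coeff ((r , G) ∷ v) H with G ≟G H
  ... | yes _ = r + coeff v H
  ... | no _  = coeff v H

  _≈Γ_ : Comb → Comb → Set ℓ
  v ≈Γ w = ∀ H → coeff v H ≈ coeff w H

  data Gen : Comb → Set c where
    gen-a : ∀ (H : Graph n) (i j : Fin n) (p : i ≢ j) (q : j ≢ i) (col : Color) →
      Gen ((1# , addEdge H i j p col) ∷ (1# , addEdge H j i q col) ∷ [])
    gen-b : ∀ (H : Graph n) (i j k : Fin n)
      (ij : i ≢ j) (jk : j ≢ k) (ki : k ≢ i) (col : Color) →
      Gen ( (1# , addEdge (addEdge H i j ij col) j k jk col)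
          ∷ (1# , addEdge (addEdge H j k jk col) k i ki col)
          ∷ (1# , addEdge (addEdge H k i ki col) i j ij col) ∷ [])
    gen-c : ∀ (H : Graph n) (i j k : Fin n)
      (ij : i ≢ j) (jk : j ≢ k) (ki : k ≢ i) →
      Gen ( (1# , addEdge (addEdge H i j ij blue) j k jk red)
          ∷ (1# , addEdge (addEdge H i j ij red) j k jk blue)
          ∷ (1# , addEdge (addEdge H j k jk blue) k i ki red)
          ∷ (1# , addEdge (addEdge H j k jk red) k i ki blue)
          ∷ (1# , addEdge (addEdge H k i ki blue) i j ij red)
          ∷ (1# , addEdge (addEdge H k i ki red) i j ij blue) ∷ [])
    gen-d : ∀ (G : Graph n) (i j : Fin n) → i ≢ j → between G i j ≥ 2 →
      Gen ((1# , G) ∷ [])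
    gen-e : ∀ (G : Graph n) → ¬ Connected G → Gen ((1# , G) ∷ [])

  sumR : List Carrier → Carrier
  sumR = foldr _+_ 0#

  InI : Comb → Set (c ⊔ ℓ)
  InI v = Σ (List (Carrier × Σ Comb Gen)) λ ts →
            ∀ H → coeff v H ≈ sumR (map (λ t → proj₁ t * coeff (proj₁ (proj₂ t)) H) ts)

  ClassIsZero : Graph n → Set (c ⊔ ℓ)
  ClassIsZero G = InI ((1# , G) ∷ [])

-- Disconnected graphs and graphs with a double edge are generators of I_n. For a
-- cycle v₀ – v₁ – … – v_{k-1} induct on k. Write the graph as H plus the two edges at
-- the corner v₁, oriented as v₀ → v₁ → v₂ (by (a) reorienting only changes the sign).
-- If they have the same colour, relation (b) expresses the graph through the other two
-- cyclic rotations of the path v₀ → v₁ → v₂ added to H; each contains an edge v₂ → v₀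
-- and hence the shorter cycle v₀ – v₂ – … – v_{k-1}, or a double edge when k = 3, so
-- both vanish. If the colours differ, relation (c) shows in the same way that the
-- class changes only by a sign when the two colours are exchanged. If neither the
-- corner at v₁ nor the one at v₀ is monochromatic, exchanging the colours at v₁ makes
-- the corner at v₀ monochromatic.
module Submission where

open import Defs
open import Level using (Level)
open import Data.Nat using (ℕ; zero; suc)
open import Data.Fin as Fin using (Fin; inject₁; fromℕ; punchIn)
open import Data.Fin.Patterns using (0F; 1F; 2F)
open import Data.Fin.Properties using (fromℕ≢inject₁; inject₁-injective; punchIn-injective)
open import Data.List using (List; []; _∷_; _++_; map)
open import Data.List.Relation.Unary.All using (All; []; _∷_)
import Data.List.Relation.Binary.Permutation.Propositional as ↭
open ↭ using (_↭_)
open import Data.Product using (Σ; ∃; _×_; _,_; proj₁; proj₂; map₁)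
open import Data.Sum using (_⊎_; inj₁; inj₂)
open import Data.Empty using (⊥-elim)
open import Function using (_∘_)
open import Function.Definitions using (Injective)
open import Relation.Nullary using (¬_; yes; no)
open import Relation.Binary.PropositionalEquality as ≡ using (_≡_; _≢_; refl; cong; subst)
open import Algebra.Bundles using (CommutativeRing)

module Ideal {r ℓ : Level} (R : CommutativeRing r ℓ) (n : ℕ) where
  open Eil R n
  open CommutativeRing R renaming (refl to ≈-refl; sym to ≈-sym; trans to ≈-trans)
  open import Algebra.Properties.Ring ring using (-‿distribˡ-*; -‿+-comm; -0#≈0#; xyx⁻¹≈y)
  open import Algebra.Properties.CommutativeSemigroup +-commutativeSemigroup
    using (x∙yz≈y∙xz)
  open import Relation.Binary.Reasoning.Setoid setoid

  span : List (Carrier × Σ Comb Gen) → Graph n → Carrier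
  span ts H = sumR (map (λ t → proj₁ t * coeff (proj₁ (proj₂ t)) H) ts)

  span-++ : ∀ ts us H → span (ts ++ us) H ≈ span ts H + span us H
  span-++ []       us H = ≈-sym (+-identityˡ _)
  span-++ (t ∷ ts) us H = ≈-trans (+-congˡ (span-++ ts us H)) (≈-sym (+-assoc _ _ _))

  span-negate : ∀ ts H → span (map (map₁ (-_)) ts) H ≈ - span ts H
  span-negate []       H = ≈-sym -0#≈0#
  span-negate (t ∷ ts) H = ≈-trans (+-cong (≈-sym (-‿distribˡ-* _ _)) (span-negate ts H)) (-‿+-comm _ _)

  InI-resp : ∀ {v w} → v ≈Γ w → InI w → InI v
  InI-resp v≈w (ts , w≈ts) = ts , λ H → ≈-trans (v≈w H) (w≈ts H)

  InI-gen : ∀ {v} → Gen v → InI v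
  InI-gen {v} g = (1# , v , g) ∷ [] , λ H → ≈-sym (≈-trans (+-identityʳ _) (*-identityˡ _))

  InI-+ : ∀ {u v w} → (∀ H → coeff v H ≈ coeff u H + coeff w H) → InI u → InI w → InI v
  InI-+ {u} {v} {w} v≈u+w (ts , u≈ts) (us , w≈us) = ts ++ us , λ H → begin
    coeff v H                 ≈⟨ v≈u+w H ⟩
    coeff u H + coeff w H     ≈⟨ +-cong (u≈ts H) (w≈us H) ⟩
    span ts H + span us H     ≈⟨ span-++ ts us H ⟨
    span (ts ++ us) H         ∎

  InI-- : ∀ {u v w} → (∀ H → coeff v H ≈ coeff u H - coeff w H) → InI u → InI w → InI v
  InI-- {u} {v} {w} v≈u-w (ts , u≈ts) (us , w≈us) = ts ++ map (map₁ (-_)) us , λ H → begin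
    coeff v H                            ≈⟨ v≈u-w H ⟩
    coeff u H - coeff w H                ≈⟨ +-cong (u≈ts H) (-‿cong (w≈us H)) ⟩
    span ts H - span us H                ≈⟨ +-congˡ (span-negate us H) ⟨
    span ts H + span (map (map₁ (-_)) us) H ≈⟨ span-++ ts _ H ⟨
    span (ts ++ map (map₁ (-_)) us) H      ∎

  coeff-∷ : ∀ t v H → coeff (t ∷ v) H ≈ coeff (t ∷ []) H + coeff v H
  coeff-∷ (s , G) v H with G ≟G H
  ... | yes _ = +-congʳ (≈-sym (+-identityʳ s))
  ... | no _  = ≈-sym (+-identityˡ _)

  coeff-↭ : ∀ {u w} → u ↭ w → ∀ H → coeff u H ≈ coeff w H
  coeff-↭ ↭.refl H = ≈-refl
  coeff-↭ (↭.prep t u↭w) H =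
    ≈-trans (coeff-∷ t _ H) (≈-trans (+-congˡ (coeff-↭ u↭w H)) (≈-sym (coeff-∷ t _ H)))
  coeff-↭ {s ∷ t ∷ u} {_ ∷ _ ∷ w} (↭.swap s t u↭w) H = begin
    coeff (s ∷ t ∷ u) H                   ≈⟨ ≈-trans (coeff-∷ s _ H) (+-congˡ (coeff-∷ t u H)) ⟩
    coeff (s ∷ []) H + (coeff (t ∷ []) H + coeff u H) ≈⟨ x∙yz≈y∙xz _ _ _ ⟩
    coeff (t ∷ []) H + (coeff (s ∷ []) H + coeff u H) ≈⟨ +-congˡ (+-congˡ (coeff-↭ u↭w H)) ⟩
    coeff (t ∷ []) H + (coeff (s ∷ []) H + coeff w H) ≈⟨ ≈-trans (coeff-∷ t _ H) (+-congˡ (coeff-∷ s w H)) ⟨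
    coeff (t ∷ s ∷ w) H                   ∎
  coeff-↭ (↭.trans u↭v v↭w) H = ≈-trans (coeff-↭ u↭v H) (coeff-↭ v↭w H)

  InI-↭ : ∀ {u w} → u ↭ w → InI u → InI w
  InI-↭ {u} {w} u↭w = InI-resp {w} {u} λ H → ≈-sym (coeff-↭ u↭w H)

  ones : List (Graph n) → Comb
  ones = map (1# ,_)

  InI-ones : ∀ {gs} → All ClassIsZero gs → InI (ones gs)
  InI-ones []       = [] , λ _ → ≈-refl
  InI-ones {g ∷ gs} (z ∷ zs) = InI-+ {(1# , g) ∷ []} {ones (g ∷ gs)} {ones gs} (coeff-∷ _ _) z (InI-ones zs)

  ClassIsZero-of-InI : ∀ {G gs} → InI ((1# , G) ∷ ones gs) → All ClassIsZero gs → ClassIsZero G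
  ClassIsZero-of-InI {G} {gs} I zs = InI-- {(1# , G) ∷ ones gs} {(1# , G) ∷ []} {ones gs} cancel I (InI-ones zs)
    where
    cancel : ∀ H → coeff ((1# , G) ∷ []) H ≈ coeff ((1# , G) ∷ ones gs) H - coeff (ones gs) H
    cancel H = ≈-sym (begin
      coeff ((1# , G) ∷ ones gs) H - coeff (ones gs) H                  ≈⟨ +-congʳ (coeff-∷ _ _ H) ⟩
      coeff ((1# , G) ∷ []) H + coeff (ones gs) H - coeff (ones gs) H   ≈⟨ +-congʳ (+-comm _ _) ⟩
      coeff (ones gs) H + coeff ((1# , G) ∷ []) H - coeff (ones gs) H   ≈⟨ xyx⁻¹≈y _ _ ⟩
      coeff ((1# , G) ∷ []) H                                           ∎)

  ClassIsZero-resp : ∀ {G G'} → G ≈G G' → ClassIsZero G → ClassIsZero G'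
  ClassIsZero-resp {G} {G'} G≈G' = InI-resp {(1# , G') ∷ []} {(1# , G) ∷ []} coeff-resp
    where
    coeff-resp : ∀ H → coeff ((1# , G') ∷ []) H ≈ coeff ((1# , G) ∷ []) H
    coeff-resp H with G' ≟G H | G ≟G H
    ... | yes _    | yes _    = ≈-refl
    ... | no _     | no _     = ≈-refl
    ... | yes G'≈H | no G≉H   = ⊥-elim (G≉H λ i j c → ≡.trans (G≈G' i j c) (G'≈H i j c))
    ... | no G'≉H  | yes G≈H  = ⊥-elim (G'≉H λ i j c → ≡.trans (≡.sym (G≈G' i j c)) (G≈H i j c))

  ClassIsZero-reverse : ∀ H i j (ij : i ≢ j) (ji : j ≢ i) c →
    ClassIsZero (addEdge H j i ji c) → ClassIsZero (addEdge H i j ij c)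
  ClassIsZero-reverse H i j ij ji c z = ClassIsZero-of-InI (InI-gen (gen-a H i j ij ji c)) (z ∷ [])

-- opened only after Ideal, whose ring operations share these names
open import Data.Nat using (_+_; _∸_; _≤_; _<_; z≤n; s≤s)
open import Data.Nat.Properties
  using (≤-refl; ≤-reflexive; ≤-trans; m≤m+n; m≤n+m; +-assoc; +-comm; +-suc; +-mono-≤; 0∸n≡0; m+[n∸m]≡n;
         +-commutativeSemigroup; module ≤-Reasoning)
open import Algebra.Properties.CommutativeSemigroup +-commutativeSemigroup using (x∙yz≈y∙xz)

third-colour : ∀ {c d e : Color} → c ≢ d → e ≢ c → e ≡ d
third-colour {red}  {blue} {blue} _ _ = refl
third-colour {blue} {red}  {red}  _ _ = refl
third-colour {red}  {red}  c≢d _   = ⊥-elim (c≢d refl)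
third-colour {blue} {blue} c≢d _   = ⊥-elim (c≢d refl)
third-colour {red}  {blue} {red}  _ e≢c = ⊥-elim (e≢c refl)
third-colour {blue} {red}  {blue} _ e≢c = ⊥-elim (e≢c refl)

positive-+ : ∀ m {k} → 1 ≤ m + k → 1 ≤ m ⊎ 1 ≤ k
positive-+ zero    1≤k = inj₂ 1≤k
positive-+ (suc m) _   = inj₁ (s≤s z≤n)

cyclicPred : ∀ {k} → Fin (suc k) → Fin (suc k)
cyclicPred 0F      = fromℕ _
cyclicPred (Fin.suc i) = inject₁ i

cyclicPred-injective : ∀ {k} → Injective _≡_ _≡_ (cyclicPred {k})
cyclicPred-injective {x = 0F}        {0F}        _  = refl
cyclicPred-injective {x = 0F}        {Fin.suc j} eq = ⊥-elim (fromℕ≢inject₁ eq)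
cyclicPred-injective {x = Fin.suc i} {0F}        eq = ⊥-elim (fromℕ≢inject₁ (≡.sym eq))
cyclicPred-injective {x = Fin.suc i} {Fin.suc j} eq = cong Fin.suc (inject₁-injective eq)

module _ {n : ℕ} where

  singleEdge : (i j : Fin n) → Color → (x y : Fin n) → Color → ℕ
  singleEdge i j c x y d with x Fin.≟ i | y Fin.≟ j | d ≟c c
  ... | yes _ | yes _ | yes _ = 1
  ... | _     | _     | _     = 0

  singleEdge-hit : ∀ (i j : Fin n) c → singleEdge i j c i j c ≡ 1
  singleEdge-hit i j c with i Fin.≟ i | j Fin.≟ j | c ≟c c
  ... | yes _  | yes _  | yes _  = refl
  ... | no i≢i | _      | _      = ⊥-elim (i≢i refl)
  ... | yes _  | no j≢j | _      = ⊥-elim (j≢j refl)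
  ... | yes _  | yes _  | no c≢c = ⊥-elim (c≢c refl)

  singleEdge-miss : ∀ {i j : Fin n} {c x y d} → ¬ (x ≡ i × y ≡ j × d ≡ c) → singleEdge i j c x y d ≡ 0
  singleEdge-miss {i} {j} {c} {x} {y} {d} miss with x Fin.≟ i | y Fin.≟ j | d ≟c c
  ... | yes x≡i | yes y≡j | yes d≡c = ⊥-elim (miss (x≡i , y≡j , d≡c))
  ... | yes _   | yes _   | no _    = refl
  ... | yes _   | no _    | _       = refl
  ... | no _    | _       | _       = refl

  singleEdge-≤ : ∀ G i j c x y d → 1 ≤ mult G i j c → singleEdge i j c x y d ≤ mult G x y d
  singleEdge-≤ G i j c x y d 1≤m with x Fin.≟ i | y Fin.≟ j | d ≟c c
  ... | yes refl | yes refl | yes refl = 1≤m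
  ... | yes _    | yes _    | no _     = z≤n
  ... | yes _    | no _     | _        = z≤n
  ... | no _     | _        | _        = z≤n

  addEdge-mult : ∀ (H : Graph n) i j (ij : i ≢ j) c x y d →
    mult (addEdge H i j ij c) x y d ≡ singleEdge i j c x y d + mult H x y d
  addEdge-mult H i j ij c x y d with x Fin.≟ i | y Fin.≟ j | d ≟c c
  ... | yes _ | yes _ | yes _ = refl
  ... | yes _ | yes _ | no _  = refl
  ... | yes _ | no _  | _     = refl
  ... | no _  | _     | _     = refl

  addEdge-cong : ∀ {G G' : Graph n} i j (ij : i ≢ j) c → G ≈G G' → addEdge G i j ij c ≈G addEdge G' i j ij c
  addEdge-cong {G} {G'} i j ij c G≈G' x y d = begin
    mult (addEdge G i j ij c) x y d     ≡⟨ addEdge-mult G i j ij c x y d ⟩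
    singleEdge i j c x y d + mult G x y d  ≡⟨ cong (singleEdge i j c x y d +_) (G≈G' x y d) ⟩
    singleEdge i j c x y d + mult G' x y d ≡⟨ addEdge-mult G' i j ij c x y d ⟨
    mult (addEdge G' i j ij c) x y d    ∎
    where open ≡.≡-Reasoning

  addEdge-comm : ∀ (H : Graph n) i j (ij : i ≢ j) c k l (kl : k ≢ l) d →
    addEdge (addEdge H i j ij c) k l kl d ≈G addEdge (addEdge H k l kl d) i j ij c
  addEdge-comm H i j ij c k l kl d x y e = begin
    mult (addEdge (addEdge H i j ij c) k l kl d) x y e ≡⟨ addEdge-mult _ k l kl d x y e ⟩
    δkl + mult (addEdge H i j ij c) x y e               ≡⟨ cong (δkl +_) (addEdge-mult H i j ij c x y e) ⟩
    δkl + (δij + mult H x y e)                          ≡⟨ x∙yz≈y∙xz δkl δij (mult H x y e) ⟩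
    δij + (δkl + mult H x y e)                          ≡⟨ cong (δij +_) (addEdge-mult H k l kl d x y e) ⟨
    δij + mult (addEdge H k l kl d) x y e               ≡⟨ addEdge-mult _ i j ij c x y e ⟨
    mult (addEdge (addEdge H k l kl d) i j ij c) x y e ∎
    where
    open ≡.≡-Reasoning
    δij = singleEdge i j c x y e
    δkl = singleEdge k l d x y e

  removeEdge : Graph n → Fin n → Fin n → Color → Graph n
  removeEdge G i j c = record
    { mult   = λ x y d → mult G x y d ∸ singleEdge i j c x y d
    ; noLoop = λ x d →
        ≡.trans (cong (_∸ singleEdge i j c x x d) (noLoop G x d)) (0∸n≡0 (singleEdge i j c x x d))
    }

  addEdge-removeEdge : ∀ (G : Graph n) i j (ij : i ≢ j) c → 1 ≤ mult G i j c →
    addEdge (removeEdge G i j c) i j ij c ≈G G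
  addEdge-removeEdge G i j ij c 1≤m x y d =
    ≡.trans (addEdge-mult (removeEdge G i j c) i j ij c x y d) (m+[n∸m]≡n (singleEdge-≤ G i j c x y d 1≤m))

  removeEdge-miss : ∀ (G : Graph n) i j c x y d → ¬ (x ≡ i × y ≡ j) →
    mult (removeEdge G i j c) x y d ≡ mult G x y d
  removeEdge-miss G i j c x y d miss =
    cong (mult G x y d ∸_) (singleEdge-miss λ (x≡i , y≡j , _) → miss (x≡i , y≡j))

  mult≤between : ∀ (G : Graph n) i j c → mult G i j c ≤ between G i j
  mult≤between G i j c =
    ≤-trans (≤-trans (colour≤ c) (m≤m+n (a + b) (mult G j i red))) (m≤m+n _ (mult G j i blue))
    where
    a = mult G i j red
    b = mult G i j blue
    colour≤ : ∀ c → mult G i j c ≤ a + b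
    colour≤ red  = m≤m+n a b
    colour≤ blue = m≤n+m b a

  between-sym : ∀ (G : Graph n) i j → between G i j ≡ between G j i
  between-sym G i j = begin
    (a + b) + c + d   ≡⟨ +-assoc (a + b) c d ⟩
    (a + b) + (c + d) ≡⟨ +-comm (a + b) (c + d) ⟩
    (c + d) + (a + b) ≡⟨ +-assoc (c + d) a b ⟨
    (c + d) + a + b   ∎
    where
    open ≡.≡-Reasoning
    a = mult G i j red
    b = mult G i j blue
    c = mult G j i red
    d = mult G j i blue

  between-addEdge : ∀ (H : Graph n) i j (ij : i ≢ j) c → between (addEdge H i j ij c) i j ≡ suc (between H i j)
  between-addEdge H i j ij c
    rewrite addEdge-mult H i j ij c i j red | addEdge-mult H i j ij c i j blue
          | addEdge-mult H i j ij c j i red | addEdge-mult H i j ij c j i blue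
          | singleEdge-miss {i} {j} {c} {j} {i} {red}  (λ (j≡i , _) → ij (≡.sym j≡i))
          | singleEdge-miss {i} {j} {c} {j} {i} {blue} (λ (j≡i , _) → ij (≡.sym j≡i))
    with c
  ... | red  rewrite singleEdge-hit i j red  | singleEdge-miss {i} {j} {red} {i} {j} {blue} (λ { (_ , _ , ()) }) = refl
  ... | blue rewrite singleEdge-hit i j blue | singleEdge-miss {i} {j} {blue} {i} {j} {red} (λ { (_ , _ , ()) })
    = cong (λ k → k + mult H j i red + mult H j i blue) (+-suc _ _)

  Adj-sym : ∀ {G : Graph n} {i j} → Adj G i j → Adj G j i
  Adj-sym {G} {i} {j} = subst (1 ≤_) (between-sym G i j)

  data Linked (G : Graph n) (i j : Fin n) (c : Color) : Set where
    forward  : 1 ≤ mult G i j c → Linked G i j c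
    backward : 1 ≤ mult G j i c → Linked G i j c

  Linked⇒Adj : ∀ {G : Graph n} {i j c} → Linked G i j c → Adj G i j
  Linked⇒Adj {G} {i} {j} {c} (forward 1≤m) = ≤-trans 1≤m (mult≤between G i j c)
  Linked⇒Adj {G} {i} {j} {c} (backward 1≤m) = Adj-sym {G} {j} {i} (≤-trans 1≤m (mult≤between G j i c))

  Adj⇒Linked : ∀ {G : Graph n} {i j} → Adj G i j → ∃ (Linked G i j)
  Adj⇒Linked {G} {i} {j} adj with positive-+ (mult G i j red + mult G i j blue + mult G j i red) adj
  ... | inj₂ blue-ji = blue , backward blue-ji
  ... | inj₁ adj′ with positive-+ (mult G i j red + mult G i j blue) adj′
  ...   | inj₂ red-ji = red , backward red-ji
  ...   | inj₁ adj″ with positive-+ (mult G i j red) adj″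
  ...     | inj₁ red-ij  = red , forward red-ij
  ...     | inj₂ blue-ij = blue , forward blue-ij

  addEdge-Linked : ∀ (H : Graph n) i j (ij : i ≢ j) c → Linked (addEdge H i j ij c) i j c
  addEdge-Linked H i j ij c = forward (≤-trans (s≤s z≤n) (≤-reflexive (≡.sym (begin
    mult (addEdge H i j ij c) i j c ≡⟨ addEdge-mult H i j ij c i j c ⟩
    singleEdge i j c i j c + _      ≡⟨ cong (_+ mult H i j c) (singleEdge-hit i j c) ⟩
    suc (mult H i j c)              ∎))))
    where open ≡.≡-Reasoning

  data Extends (G H : Graph n) (i j : Fin n) (ij : i ≢ j) (c : Color) : Set where
    forward  : addEdge H i j ij c ≈G G → Extends G H i j ij c
    backward : addEdge H j i (ij ∘ ≡.sym) c ≈G G → Extends G H i j ij c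

  Extends-addEdge : ∀ {G H : Graph n} {i j ij c} k l (kl : k ≢ l) d →
    Extends G H i j ij c → Extends (addEdge G k l kl d) (addEdge H k l kl d) i j ij c
  Extends-addEdge {H = H} {i} {j} {ij} {c} k l kl d (forward G≈) = forward λ x y e →
    ≡.trans (addEdge-comm H k l kl d i j ij c x y e) (addEdge-cong k l kl d G≈ x y e)
  Extends-addEdge {H = H} {i} {j} {ij} {c} k l kl d (backward G≈) = backward λ x y e →
    ≡.trans (addEdge-comm H k l kl d j i (ij ∘ ≡.sym) c x y e) (addEdge-cong k l kl d G≈ x y e)

  record _⊑_∖_ (G H : Graph n) (b : Fin n) : Set where
    constructor ⊑∖
    field
      mult-≤ : ∀ x y d → x ≢ b → y ≢ b → mult G x y d ≤ mult H x y d
  open _⊑_∖_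

  ⊑∖-refl : ∀ {G : Graph n} {b} → G ⊑ G ∖ b
  ⊑∖-refl = ⊑∖ λ _ _ _ _ _ → ≤-refl

  ⊑∖-trans : ∀ {G H K : Graph n} {b} → G ⊑ H ∖ b → H ⊑ K ∖ b → G ⊑ K ∖ b
  ⊑∖-trans G⊑H H⊑K = ⊑∖ λ x y d x≢b y≢b →
    ≤-trans (mult-≤ G⊑H x y d x≢b y≢b) (mult-≤ H⊑K x y d x≢b y≢b)

  ⊑∖-addEdge : ∀ {G H : Graph n} {b} i j (ij : i ≢ j) c → G ⊑ H ∖ b → G ⊑ addEdge H i j ij c ∖ b
  ⊑∖-addEdge {H = H} i j ij c G⊑H = ⊑∖ λ x y d x≢b y≢b →
    ≤-trans (mult-≤ G⊑H x y d x≢b y≢b)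
            (≤-trans (m≤n+m _ _) (≤-reflexive (≡.sym (addEdge-mult H i j ij c x y d))))

  ⊑∖-removeEdge : ∀ (G : Graph n) i j c → G ⊑ removeEdge G i j c ∖ i × G ⊑ removeEdge G i j c ∖ j
  ⊑∖-removeEdge G i j c =
      ⊑∖ (λ x y d x≢i _ → ≤-reflexive (≡.sym (removeEdge-miss G i j c x y d (x≢i ∘ proj₁))))
    , ⊑∖ (λ x y d _ y≢j → ≤-reflexive (≡.sym (removeEdge-miss G i j c x y d (y≢j ∘ proj₂))))

  between-mono : ∀ {G H : Graph n} {b i j} → G ⊑ H ∖ b → i ≢ b → j ≢ b → between G i j ≤ between H i j
  between-mono G⊑H i≢b j≢b =
    +-mono-≤ (+-mono-≤ (+-mono-≤ (mult-≤ G⊑H _ _ red i≢b j≢b) (mult-≤ G⊑H _ _ blue i≢b j≢b))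
                       (mult-≤ G⊑H _ _ red j≢b i≢b))
             (mult-≤ G⊑H _ _ blue j≢b i≢b)

  Adj-mono : ∀ {G H : Graph n} {b i j} → G ⊑ H ∖ b → i ≢ b → j ≢ b → Adj G i j → Adj H i j
  Adj-mono G⊑H i≢b j≢b adj = ≤-trans adj (between-mono G⊑H i≢b j≢b)

  Linked-mono : ∀ {G H : Graph n} {b i j c} → G ⊑ H ∖ b → i ≢ b → j ≢ b → Linked G i j c → Linked H i j c
  Linked-mono G⊑H i≢b j≢b (forward 1≤m)  = forward (≤-trans 1≤m (mult-≤ G⊑H _ _ _ i≢b j≢b))
  Linked-mono G⊑H i≢b j≢b (backward 1≤m) = backward (≤-trans 1≤m (mult-≤ G⊑H _ _ _ j≢b i≢b))

  peel : ∀ {G : Graph n} {i j c} (ij : i ≢ j) → Linked G i j c →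
    Σ (Graph n) λ H → Extends G H i j ij c × G ⊑ H ∖ i × G ⊑ H ∖ j
  peel {G} {i} {j} {c} ij (forward 1≤m) =
    removeEdge G i j c , forward (addEdge-removeEdge G i j ij c 1≤m) , ⊑∖-removeEdge G i j c
  peel {G} {i} {j} {c} ij (backward 1≤m) =
    removeEdge G j i c , backward (addEdge-removeEdge G j i (ij ∘ ≡.sym) c 1≤m) ,
    proj₂ (⊑∖-removeEdge G j i c) , proj₁ (⊑∖-removeEdge G j i c)

  record IsCycle {m} (G : Graph n) (v : Fin (3 + m) → Fin n) : Set where
    field
      injective : Injective _≡_ _≡_ v
      adjacent  : ∀ (t : Fin (2 + m)) → Adj G (v (inject₁ t)) (v (Fin.suc t))
      closing   : Adj G (v (fromℕ (2 + m))) (v 0F)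

    distinct : ∀ {s t} → s ≢ t → v s ≢ v t
    distinct s≢t = s≢t ∘ injective

  open IsCycle public

  IsCycle-rotate : ∀ {m} {G : Graph n} {v : Fin (3 + m) → Fin n} → IsCycle G v → IsCycle G (v ∘ cyclicPred)
  IsCycle-rotate {m} cyc = record
    { injective = cyclicPred-injective ∘ injective cyc
    ; adjacent  = λ { 0F → closing cyc ; (Fin.suc t) → adjacent cyc (inject₁ t) }
    ; closing   = adjacent cyc (fromℕ (suc m))
    }

  IsCycle-mono : ∀ {m} {G T : Graph n} {c d} {v : Fin (3 + m) → Fin n} → IsCycle G v → G ⊑ T ∖ v 1F →
    Linked T (v 0F) (v 1F) c → Linked T (v 1F) (v 2F) d → IsCycle T v
  IsCycle-mono {T = T} cyc G⊑T l₀₁ l₁₂ = record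
    { injective = injective cyc
    ; adjacent  = λ { 0F → Linked⇒Adj {G = T} l₀₁ ; 1F → Linked⇒Adj {G = T} l₁₂
                    ; (Fin.suc (Fin.suc t)) → Adj-mono G⊑T (distinct cyc λ ()) (distinct cyc λ ())
                                                (adjacent cyc (Fin.suc (Fin.suc t))) }
    ; closing   = Adj-mono G⊑T (distinct cyc λ ()) (distinct cyc λ ()) (closing cyc)
    }

  IsCycle-bypass : ∀ {m} {G T : Graph n} {v : Fin (4 + m) → Fin n} → IsCycle G v → G ⊑ T ∖ v 1F →
    Adj T (v 0F) (v 2F) → IsCycle T (v ∘ punchIn 1F)
  IsCycle-bypass cyc G⊑T adj₀₂ = record
    { injective = punchIn-injective 1F _ _ ∘ injective cyc
    ; adjacent  = λ { 0F → adj₀₂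
                    ; (Fin.suc t) → Adj-mono G⊑T (distinct cyc λ ()) (distinct cyc λ ())
                                      (adjacent cyc (Fin.suc (Fin.suc t))) }
    ; closing   = Adj-mono G⊑T (distinct cyc λ ()) (distinct cyc λ ()) (closing cyc)
    }

module Cycles {r ℓ : Level} (R : CommutativeRing r ℓ) (n : ℕ) where
  open Eil R n
  open Ideal R n

  ClassIsZero-extends : ∀ {G H : Graph n} {i j ij c} → Extends G H i j ij c →
    ClassIsZero (addEdge H i j ij c) → ClassIsZero G
  ClassIsZero-extends (forward G≈) = ClassIsZero-resp G≈
  ClassIsZero-extends {H = H} {i} {j} {ij} {c} (backward G≈) =
    ClassIsZero-resp G≈ ∘ ClassIsZero-reverse H j i (ij ∘ ≡.sym) ij c

  split-path : ∀ {G : Graph n} {i j k c d} (ij : i ≢ j) (jk : j ≢ k) → i ≢ k → Linked G i j c → Linked G j k d →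
    Σ (Graph n) λ H → (ClassIsZero (addEdge (addEdge H i j ij c) j k jk d) → ClassIsZero G) × G ⊑ H ∖ j
  split-path ij jk ik l₁ l₂ with peel ij l₁
  ... | H₁ , ext₁ , G⊑H₁∖i , G⊑H₁∖j with peel jk (Linked-mono G⊑H₁∖i (ij ∘ ≡.sym) (ik ∘ ≡.sym) l₂)
  ... | H₂ , ext₂ , H₁⊑H₂∖j , _ =
      H₂
    , ClassIsZero-extends ext₁ ∘ ClassIsZero-extends (Extends-addEdge _ _ ij _ ext₂)
    , ⊑∖-trans G⊑H₁∖j H₁⊑H₂∖j

  CyclesVanish : ℕ → Set _
  CyclesVanish m = ∀ {G} {v : Fin (3 + m) → Fin n} → IsCycle G v → ClassIsZero G

  -- T contains the cycle v of G, except perhaps the two edges at v 1F, and one more edge between v 2F and v 0F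
  ShortcutsVanish : ℕ → Set _
  ShortcutsVanish m = ∀ {G T} {v : Fin (3 + m) → Fin n} → IsCycle G v → G ⊑ T ∖ v 1F →
    between G (v 2F) (v 0F) < between T (v 2F) (v 0F) → ClassIsZero T

  shortcuts-vanish-triangle : ShortcutsVanish 0
  shortcuts-vanish-triangle {T = T} {v} cyc _ more =
    InI-gen (gen-d T (v 2F) (v 0F) (distinct cyc λ ()) (≤-trans (s≤s (closing cyc)) more))

  shortcuts-vanish-from-cycles : ∀ {m} → CyclesVanish m → ShortcutsVanish (suc m)
  shortcuts-vanish-from-cycles vanish {T = T} {v} cyc G⊑T more =
    vanish (IsCycle-bypass cyc G⊑T (Adj-sym {G = T} {v 2F} {v 0F} (≤-trans (s≤s z≤n) more)))

  module Corner {m} (shortcuts : ShortcutsVanish m) {G} {v : Fin (3 + m) → Fin n} (cyc : IsCycle G v) where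

    v₀≢v₁ : v 0F ≢ v 1F
    v₀≢v₁ = distinct cyc λ ()

    v₁≢v₂ : v 1F ≢ v 2F
    v₁≢v₂ = distinct cyc λ ()

    v₂≢v₀ : v 2F ≢ v 0F
    v₂≢v₀ = distinct cyc λ ()

    path₀₁₂ path₁₂₀ path₂₀₁ : Graph n → Color → Color → Graph n
    path₀₁₂ H c d = addEdge (addEdge H (v 0F) (v 1F) v₀≢v₁ c) (v 1F) (v 2F) v₁≢v₂ d
    path₁₂₀ H c d = addEdge (addEdge H (v 1F) (v 2F) v₁≢v₂ c) (v 2F) (v 0F) v₂≢v₀ d
    path₂₀₁ H c d = addEdge (addEdge H (v 2F) (v 0F) v₂≢v₀ c) (v 0F) (v 1F) v₀≢v₁ d

    rotations-vanish : ∀ {H} → G ⊑ H ∖ v 1F → ∀ c d →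
      ClassIsZero (path₁₂₀ H c d) × ClassIsZero (path₂₀₁ H c d)
    rotations-vanish {H} G⊑H c d =
        shortcuts cyc (⊑∖-addEdge _ _ v₂≢v₀ d G⊑H₁₂) (begin-strict
          between G (v 2F) (v 0F)   ≤⟨ between-mono G⊑H₁₂ v₂≢v₁ v₀≢v₁ ⟩
          between H₁₂ (v 2F) (v 0F) <⟨ ≤-reflexive (≡.sym (between-addEdge H₁₂ _ _ v₂≢v₀ d)) ⟩
          between (path₁₂₀ H c d) (v 2F) (v 0F) ∎)
      , shortcuts cyc (⊑∖-addEdge _ _ v₀≢v₁ d (⊑∖-addEdge _ _ v₂≢v₀ c G⊑H)) (begin-strict
          between G (v 2F) (v 0F)   ≤⟨ between-mono G⊑H v₂≢v₁ v₀≢v₁ ⟩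
          between H (v 2F) (v 0F)   <⟨ ≤-reflexive (≡.sym (between-addEdge H _ _ v₂≢v₀ c)) ⟩
          between H₂₀ (v 2F) (v 0F) ≤⟨ between-mono (⊑∖-addEdge {b = v 1F} _ _ v₀≢v₁ d ⊑∖-refl) v₂≢v₁ v₀≢v₁ ⟩
          between (path₂₀₁ H c d) (v 2F) (v 0F) ∎)
      where
      open ≤-Reasoning
      v₂≢v₁ = v₁≢v₂ ∘ ≡.sym
      H₁₂ = addEdge H (v 1F) (v 2F) v₁≢v₂ c
      H₂₀ = addEdge H (v 2F) (v 0F) v₂≢v₀ c
      G⊑H₁₂ : G ⊑ H₁₂ ∖ v 1F
      G⊑H₁₂ = ⊑∖-addEdge _ _ v₁≢v₂ c G⊑H

    monochromatic : ∀ {c} → Linked G (v 0F) (v 1F) c → Linked G (v 1F) (v 2F) c → ClassIsZero G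
    monochromatic {c} l₀₁ l₁₂ with split-path v₀≢v₁ v₁≢v₂ (v₂≢v₀ ∘ ≡.sym) l₀₁ l₁₂
    ... | H , back , G⊑H = back (ClassIsZero-of-InI
      (InI-gen (gen-b H (v 0F) (v 1F) (v 2F) v₀≢v₁ v₁≢v₂ v₂≢v₀ c))
      (proj₁ (rotations-vanish G⊑H c c) ∷ proj₂ (rotations-vanish G⊑H c c) ∷ []))

    mixed-rotations-vanish : ∀ {H} → G ⊑ H ∖ v 1F → All ClassIsZero
      (path₁₂₀ H blue red ∷ path₁₂₀ H red blue ∷ path₂₀₁ H blue red ∷ path₂₀₁ H red blue ∷ [])
    mixed-rotations-vanish G⊑H =
      proj₁ (rotations-vanish G⊑H blue red) ∷ proj₁ (rotations-vanish G⊑H red blue) ∷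
      proj₂ (rotations-vanish G⊑H blue red) ∷ proj₂ (rotations-vanish G⊑H red blue) ∷ []

    exchange-colours : ∀ {H c d} → G ⊑ H ∖ v 1F → c ≢ d →
      ClassIsZero (path₀₁₂ H d c) → ClassIsZero (path₀₁₂ H c d)
    exchange-colours {c = red}  {red}  _ c≢d _ = ⊥-elim (c≢d refl)
    exchange-colours {c = blue} {blue} _ c≢d _ = ⊥-elim (c≢d refl)
    exchange-colours {H} {blue} {red}  G⊑H _ z =
      ClassIsZero-of-InI (InI-gen (gen-c H (v 0F) (v 1F) (v 2F) v₀≢v₁ v₁≢v₂ v₂≢v₀))
        (z ∷ mixed-rotations-vanish G⊑H)
    exchange-colours {H} {red}  {blue} G⊑H _ z =
      -- relation (c) lists this path second
      ClassIsZero-of-InI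
        (InI-↭ (↭.swap _ _ ↭.refl) (InI-gen (gen-c H (v 0F) (v 1F) (v 2F) v₀≢v₁ v₁≢v₂ v₂≢v₀)))
        (z ∷ mixed-rotations-vanish G⊑H)

    recolour-corner : ∀ {c d} → c ≢ d → Linked G (v 0F) (v 1F) c → Linked G (v 1F) (v 2F) d →
      Σ (Graph n) λ G' → (ClassIsZero G' → ClassIsZero G) × IsCycle G' v × Linked G' (v 0F) (v 1F) d × G ⊑ G' ∖ v 1F
    recolour-corner {c} {d} c≢d l₀₁ l₁₂ with split-path v₀≢v₁ v₁≢v₂ (v₂≢v₀ ∘ ≡.sym) l₀₁ l₁₂
    ... | H , back , G⊑H =
        path₀₁₂ H d c
      , back ∘ exchange-colours G⊑H c≢d
      , IsCycle-mono cyc G⊑G' l₀₁' (addEdge-Linked H₀₁ _ _ v₁≢v₂ c)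
      , l₀₁'
      , G⊑G'
      where
      H₀₁ = addEdge H (v 0F) (v 1F) v₀≢v₁ d
      G⊑G' : G ⊑ path₀₁₂ H d c ∖ v 1F
      G⊑G' = ⊑∖-addEdge _ _ v₁≢v₂ c (⊑∖-addEdge _ _ v₀≢v₁ d G⊑H)
      l₀₁' : Linked (path₀₁₂ H d c) (v 0F) (v 1F) d
      l₀₁' = Linked-mono {b = v 2F} (⊑∖-addEdge _ _ v₁≢v₂ c ⊑∖-refl) (v₂≢v₀ ∘ ≡.sym) v₁≢v₂
               (addEdge-Linked H _ _ v₀≢v₁ d)

  -- IsCycle-rotate moves the corner to v (fromℕ _) – v 0F – v 1F
  cycles-vanish-from-shortcuts : ∀ {m} → ShortcutsVanish m → CyclesVanish m
  cycles-vanish-from-shortcuts {m} shortcuts {G} {v} cyc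
    with Adj⇒Linked {G = G} (adjacent cyc 0F)
       | Adj⇒Linked {G = G} (adjacent cyc 1F)
       | Adj⇒Linked {G = G} (closing cyc)
  ... | c , l₀₁ | d , l₁₂ | e , l₋₀ with c ≟c d | e ≟c c
  ... | yes refl | _        = Corner.monochromatic shortcuts cyc l₀₁ l₁₂
  ... | no _     | yes refl = Corner.monochromatic shortcuts (IsCycle-rotate cyc) l₋₀ l₀₁
  ... | no c≢d   | no e≢c   with Corner.recolour-corner shortcuts cyc c≢d l₀₁ l₁₂
  ...   | G' , back , cyc' , l₀₁' , G⊑G' =
    back (Corner.monochromatic shortcuts (IsCycle-rotate cyc') l₋₀' l₀₁')
    where
    l₋₀' : Linked G' (v (fromℕ (2 + m))) (v 0F) d
    l₋₀' = subst (Linked G' _ _) (third-colour c≢d e≢c)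
             (Linked-mono G⊑G' (distinct cyc λ ()) (distinct cyc λ ()) l₋₀)

  cycles-vanish : ∀ m → CyclesVanish m
  shortcuts-vanish : ∀ m → ShortcutsVanish m

  cycles-vanish m = cycles-vanish-from-shortcuts (shortcuts-vanish m)

  shortcuts-vanish zero    = shortcuts-vanish-triangle
  shortcuts-vanish (suc m) = shortcuts-vanish-from-cycles (cycles-vanish m)

lemma6p4 : ∀ {c ℓ : Level} (R : CommutativeRing c ℓ) (n : ℕ) (G : Graph n) →
    (¬ Connected G ⊎ HasCycle G) → Eil.ClassIsZero R n G
lemma6p4 R n G (inj₁ disconnected) =
  Ideal.InI-gen R n (Eil.gen-e G disconnected)
lemma6p4 R n G (inj₂ (inj₁ (i , j , i≢j , parallel))) =
  Ideal.InI-gen R n (Eil.gen-d G i j i≢j parallel)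
lemma6p4 R n G (inj₂ (inj₂ (m , v , injective , adjacent , closing))) =
  Cycles.cycles-vanish R n m (record { injective = injective ; adjacent = adjacent ; closing = closing })
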